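{- Let $(S,B)$ be a monoid with tests with a unary operation $D$ and a quaternary operation $(s,\alpha)[t,u]$ ($s,t,u\in S$, $\alpha\in B$) such that, for all $s,t,u\in S$ and $\alpha\in B$: $D(s)s=s$; $D(st)=D(s)D(st)$; $D(s)D(t)=D(t)D(s)$; $D(D(s))=D(s)$; $sD(t)=D(st)s$; $D(\alpha)=\alpha$; $D(s\alpha)\,(s,\alpha)[t,u]=D(s\alpha)t$; $D(s\alpha')\,(s,\alpha)[t,u]=D(s\alpha')u$; and $D((s,\alpha)[t,u])\le D(s)$. Then the quasi-identity $$D(s\beta)t=D(s\beta)u \ \text{ and }\ D(s\beta')t=D(s\beta')u\ \Rightarrow\ D(s)t=D(s)u\qquad(s,t,u\in S,\ \beta\in B)$$ holds in $(S,B)$ if and only if the identities $$D(s)t=(s,\alpha)[t,t]\quad\text{and}\quad (s,\alpha)[t,u]=(s,\alpha)[D(s\alpha)t,\,D(s\alpha')u]$$ hold for all $s,t,u\in S$, $\alpha\in B$.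
   Context: A monoid with tests is a pair $(S,B)$ where $S$ is a monoid with identity $1$ and zero $0$, and $B\subseteq S$ is a commutative submonoid of idempotents containing $0$ with a unary operation $'$ making $(B,\cdot,{}',0,1)$ a Boolean algebra with meet the multiplication. For $\mathsf e,\mathsf f\in D(S)=\{D(s)\mid s\in S\}$, $\mathsf e\le \mathsf f$ means $\mathsf e=\mathsf e\mathsf f$. -}

module Defs where

open import Relation.Binary.PropositionalEquality using (_≡_)
open import Algebra.Lattice.Structures using (IsBooleanAlgebra)
open import Function.Definitions using (Injective)
open import Data.Product using (_×_)

-- A monoid with tests (S , B): S a monoid with identity 1# and zero 0#,
-- B a subset of S (given as a type B with an injective inclusion ι),
-- closed under the multiplication, containing 0# and 1#, and carrying a
-- complement _′ making (B , · , ′ , 0 , 1) a Boolean algebra whose meet is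
-- the multiplication of S.  (The join _∨_ is part of the data; in a Boolean
-- algebra it is determined by meet and complement.)
record MonoidWithTests : Set₁ where
  infixl 7 _·_
  field
    S      : Set
    _·_    : S → S → S
    1#     : S
    0#     : S
    ·-assoc : ∀ x y z → (x · y) · z ≡ x · (y · z)
    ·-identityˡ : ∀ x → 1# · x ≡ x
    ·-identityʳ : ∀ x → x · 1# ≡ x
    ·-zeroˡ : ∀ x → 0# · x ≡ 0#
    ·-zeroʳ : ∀ x → x · 0# ≡ 0#
    B      : Set
    ι      : B → S
    ι-injective : Injective _≡_ _≡_ ι
    _∧_    : B → B → B
    _∨_    : B → B → B
    _′     : B → B
    ⊤ᴮ     : B
    ⊥ᴮ     : B
    ι-∧    : ∀ α β → ι (α ∧ β) ≡ ι α · ι β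
    ι-⊤    : ι ⊤ᴮ ≡ 1#
    ι-⊥    : ι ⊥ᴮ ≡ 0#
    isBooleanAlgebra : IsBooleanAlgebra {A = B} _≡_ _∨_ _∧_ _′ ⊤ᴮ ⊥ᴮ

  _≤D_ : S → S → Set
  e ≤D f = e ≡ e · f

-- The hypotheses on D and the quaternary operation (s , α)[ t , u ] = q s α t u.
record Axioms (M : MonoidWithTests) (D : MonoidWithTests.S M → MonoidWithTests.S M)
              (q : MonoidWithTests.S M → MonoidWithTests.B M →
                   MonoidWithTests.S M → MonoidWithTests.S M → MonoidWithTests.S M) : Set where
  open MonoidWithTests M
  field
    D-left   : ∀ s → D s · s ≡ s
    D-prod   : ∀ s t → D (s · t) ≡ D s · D (s · t)
    D-comm   : ∀ s t → D s · D t ≡ D t · D s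
    D-idem   : ∀ s → D (D s) ≡ D s
    D-twist  : ∀ s t → s · D t ≡ D (s · t) · s
    D-test   : ∀ α → D (ι α) ≡ ι α
    q-then   : ∀ s α t u → D (s · ι α) · q s α t u ≡ D (s · ι α) · t
    q-else   : ∀ s α t u → D (s · ι (α ′)) · q s α t u ≡ D (s · ι (α ′)) · u
    q-dom    : ∀ s α t u → D (q s α t u) ≤D D s

QuasiIdentity : (M : MonoidWithTests) → (MonoidWithTests.S M → MonoidWithTests.S M) → Set
QuasiIdentity M D =
  ∀ s t u β → D (s · ι β) · t ≡ D (s · ι β) · u
            → D (s · ι (β ′)) · t ≡ D (s · ι (β ′)) · u
            → D s · t ≡ D s · u
  where open MonoidWithTests M

Identities : (M : MonoidWithTests) (D : MonoidWithTests.S M → MonoidWithTests.S M)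
             (q : MonoidWithTests.S M → MonoidWithTests.B M →
                  MonoidWithTests.S M → MonoidWithTests.S M → MonoidWithTests.S M) → Set
Identities M D q =
  (∀ s α t → D s · t ≡ q s α t t) ×
  (∀ s α t u → q s α t u ≡ q s α (D (s · ι α) · t) (D (s · ι (α ′)) · u))
  where open MonoidWithTests M

-- Under the quasi-identity, two elements agreeing on both branches D(sβ) and
-- D(sβ′) agree under D s; since q s α t u already lies under D s (by q-dom), it is
-- pinned down by its two branches, which gives both identities.  Conversely the
-- identities rewrite D s · t as q s β (D(sβ) t) (D(sβ′) t), where the hypotheses
-- of the quasi-identity allow replacing t by u.
module Submission where

open import Defs
open import Data.Product using (_×_; _,_)
open import Relation.Binary.PropositionalEquality

identities⇒quasiIdentity : (M : MonoidWithTests) (D : MonoidWithTests.S M → MonoidWithTests.S M)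
  (q : MonoidWithTests.S M → MonoidWithTests.B M → MonoidWithTests.S M → MonoidWithTests.S M → MonoidWithTests.S M)
  → Identities M D q → QuasiIdentity M D
identities⇒quasiIdentity M D q (D·≡q-diag , q-restrict) s t u β then-eq else-eq = begin
  D s · t                                        ≡⟨ D·≡q-diag s β t ⟩
  q s β t t                                      ≡⟨ q-restrict s β t t ⟩
  q s β (D (s · ι β) · t) (D (s · ι (β ′)) · t) ≡⟨ cong₂ (q s β) then-eq else-eq ⟩
  q s β (D (s · ι β) · u) (D (s · ι (β ′)) · u) ≡⟨ q-restrict s β u u ⟨
  q s β u u                                      ≡⟨ D·≡q-diag s β u ⟨
  D s · u                                        ∎
  where
  open MonoidWithTests M
  open ≡-Reasoning

module WithAxioms (M : MonoidWithTests) (D : MonoidWithTests.S M → MonoidWithTests.S M)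
    (q : MonoidWithTests.S M → MonoidWithTests.B M → MonoidWithTests.S M → MonoidWithTests.S M → MonoidWithTests.S M)
    (axioms : Axioms M D q) where
  open MonoidWithTests M
  open Axioms axioms
  open ≡-Reasoning

  D-idempotent : ∀ x → D x · D x ≡ D x
  D-idempotent x = subst (λ e → e · D x ≡ D x) (D-idem x) (D-left (D x))

  D-absorbs-D· : ∀ x t → D x · (D x · t) ≡ D x · t
  D-absorbs-D· x t = begin
    D x · (D x · t) ≡⟨ ·-assoc (D x) (D x) t ⟨
    (D x · D x) · t ≡⟨ cong (_· t) (D-idempotent x) ⟩
    D x · t         ∎

  D-absorbs-q : ∀ s α t u → D s · q s α t u ≡ q s α t u
  D-absorbs-q s α t u = begin
    D s · r           ≡⟨ cong (D s ·_) (D-left r) ⟨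
    D s · (D r · r)   ≡⟨ ·-assoc (D s) (D r) r ⟨
    (D s · D r) · r   ≡⟨ cong (_· r) (D-comm s r) ⟩
    (D r · D s) · r   ≡⟨ cong (_· r) (q-dom s α t u) ⟨
    D r · r           ≡⟨ D-left r ⟩
    r                 ∎
    where r = q s α t u

  quasiIdentity⇒identities : QuasiIdentity M D → Identities M D q
  quasiIdentity⇒identities quasi = D·≡q-diag , q-restrict
    where
    D·≡q-diag : ∀ s α t → D s · t ≡ q s α t t
    D·≡q-diag s α t = begin
      D s · t         ≡⟨ quasi s t (q s α t t) α (sym (q-then s α t t)) (sym (q-else s α t t)) ⟩
      D s · q s α t t ≡⟨ D-absorbs-q s α t t ⟩
      q s α t t       ∎

    q-restrict : ∀ s α t u → q s α t u ≡ q s α (D (s · ι α) · t) (D (s · ι (α ′)) · u)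
    q-restrict s α t u = begin
      q s α t u       ≡⟨ D-absorbs-q s α t u ⟨
      D s · q s α t u ≡⟨ quasi s (q s α t u) r α on-then on-else ⟩
      D s · r         ≡⟨ D-absorbs-q s α _ _ ⟩
      r               ∎
      where
      r = q s α (D (s · ι α) · t) (D (s · ι (α ′)) · u)
      on-then : D (s · ι α) · q s α t u ≡ D (s · ι α) · r
      on-then = begin
        D (s · ι α) · q s α t u         ≡⟨ q-then s α t u ⟩
        D (s · ι α) · t                 ≡⟨ D-absorbs-D· (s · ι α) t ⟨
        D (s · ι α) · (D (s · ι α) · t) ≡⟨ q-then s α _ _ ⟨
        D (s · ι α) · r                 ∎
      on-else : D (s · ι (α ′)) · q s α t u ≡ D (s · ι (α ′)) · r
      on-else = begin
        D (s · ι (α ′)) · q s α t u             ≡⟨ q-else s α t u ⟩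
        D (s · ι (α ′)) · u                     ≡⟨ D-absorbs-D· (s · ι (α ′)) u ⟨
        D (s · ι (α ′)) · (D (s · ι (α ′)) · u) ≡⟨ q-else s α _ _ ⟨
        D (s · ι (α ′)) · r                     ∎

proposition2p9 : (M : MonoidWithTests) (D : MonoidWithTests.S M → MonoidWithTests.S M)
    (q : MonoidWithTests.S M → MonoidWithTests.B M → MonoidWithTests.S M → MonoidWithTests.S M → MonoidWithTests.S M)
    → Axioms M D q
    → (QuasiIdentity M D → Identities M D q) × (Identities M D q → QuasiIdentity M D)
proposition2p9 M D q axioms =
  WithAxioms.quasiIdentity⇒identities M D q axioms , identities⇒quasiIdentity M D q
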